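{- Fix $\xi>1$. Let $\phi(u,\vec y)$ be a quantifier-free formula of $\exists\xi^{\mathbb{Z}}$ with $\vec y=(y_1,\dots,y_n)$. Let $j\in\mathbb{N}_{\ge1}$, $k\in\mathbb{Z}$ and $\vec\ell=(\ell_1,\dots,\ell_n)\in\mathbb{Z}^n$. Then $\exists\vec y\,\exists u:\ u^j=\xi^k\cdot\vec y^{\vec\ell}\land\phi$ is equivalent to $\bigvee_{\vec r=(r_1,\dots,r_n)\in R}\ \exists\vec z:\ \phi[z_i^j\cdot\xi^{r_i}/y_i : i\in[1..n]][\xi^{\frac{k+\vec\ell\cdot\vec r}{j}}\cdot\vec z^{\vec\ell}/u],$ where $R:=\{(r_1,\dots,r_n)\in[0..j-1]^n : j\text{ divides }k+\sum_{i=1}^n r_i\ell_i\}$, $\vec\ell\cdot\vec r:=\sum_{i=1}^n r_i\ell_i$, and $\vec z=(z_1,\dots,z_n)$ is a vector of fresh variables.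
   Context: $\xi^{\mathbb{Z}}=\{\xi^i:i\in\mathbb{Z}\}$; $[a..b]=[a,b]\cap\mathbb{Z}$. $\exists\xi^{\mathbb{Z}}$ is the existential theory of $(\xi^{\mathbb{Z}};0,1,\xi,+,\cdot,<,=)$ whose variables range over $\xi^{\mathbb{Z}}$ and whose atoms are integer polynomial (in)equalities in the variables and $\xi$. $\vec y^{\vec\ell}=\prod_i y_i^{\ell_i}$ (exponents may be negative). $\phi[t/x]$ denotes replacing every occurrence of $x$ by $t$ (and then clearing negative powers by multiplying (in)equalities by suitable powers of the variables and $\xi$). -}

module Defs where

open import Level using (0ℓ)
open import Data.Nat as ℕ using (ℕ; zero; suc; NonZero)
open import Data.Integer as ℤ using (ℤ; +_; -[1+_])
open import Data.Integer.DivMod using (_/ℕ_)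
open import Data.Integer.Divisibility as ℤD using ()
open import Data.Fin using (Fin; toℕ) renaming (zero to fzero; suc to fsuc)
open import Data.Product using (Σ; _×_; ∃)
open import Data.Sum using (_⊎_)
open import Data.Empty using (⊥)
open import Data.Unit using (⊤)
open import Relation.Nullary using (¬_)
open import Relation.Binary.PropositionalEquality using (_≡_)
open import Relation.Binary.Structures using (IsStrictTotalOrder)
open import Algebra.Structures using (IsCommutativeRing)
open import Function.Bundles using (_⇔_)

record RealField : Set₁ where
  infixl 6 _+_
  infixl 7 _*_
  infix 4 _<_ _≤_
  field
    Carrier : Set
    0# 1#   : Carrier
    _+_ _*_ : Carrier → Carrier → Carrier
    -_      : Carrier → Carrier
    _⁻¹     : Carrier → Carrier
    _<_     : Carrier → Carrier → Set
    isCommutativeRing : IsCommutativeRing _≡_ _+_ _*_ -_ 0# 1#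
    0≢1       : ¬ (0# ≡ 1#)
    ⁻¹-inverse : ∀ x → ¬ (x ≡ 0#) → x * (x ⁻¹) ≡ 1#
    isStrictTotalOrder : IsStrictTotalOrder _≡_ _<_
    +-mono-<  : ∀ x y z → x < y → x + z < y + z
    *-pos     : ∀ x y → 0# < x → 0# < y → 0# < x * y
  _≤_ : Carrier → Carrier → Set
  x ≤ y = x < y ⊎ x ≡ y
  field
    complete : (S : Carrier → Set) → Σ Carrier S →
               Σ Carrier (λ b → ∀ x → S x → x ≤ b) →
               Σ Carrier (λ s → (∀ x → S x → x ≤ s) ×
                                (∀ b → (∀ x → S x → x ≤ b) → s ≤ b))

data Poly (V : Set) : Set where
  var : V → Poly V
  ξ   : Poly V
  con : ℤ → Poly V
  _⊕_ _⊗_ : Poly V → Poly V → Poly V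

-- Terms allowing integer (possibly negative) powers of variables and of ξ
-- (these arise from substitutions).
data LTerm (V : Set) : Set where
  vpow : V → ℤ → LTerm V
  ξpow : ℤ → LTerm V
  con  : ℤ → LTerm V
  _⊕_ _⊗_ : LTerm V → LTerm V → LTerm V

data Formula (T : Set) : Set where
  tt ff : Formula T
  _≐_ _≺_ : T → T → Formula T
  _∧_ _∨_ : Formula T → Formula T → Formula T
  ¬' : Formula T → Formula T

mapF : {T S : Set} → (T → S) → Formula T → Formula S
mapF f tt = tt
mapF f ff = ff
mapF f (s ≐ t) = f s ≐ f t
mapF f (s ≺ t) = f s ≺ f t
mapF f (a ∧ b) = mapF f a ∧ mapF f b
mapF f (a ∨ b) = mapF f a ∨ mapF f b
mapF f (¬' a) = ¬' (mapF f a)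

substT : {V W : Set} → (V → LTerm W) → Poly V → LTerm W
substT σ (var v) = σ v
substT σ ξ = ξpow (+ 1)
substT σ (con c) = con c
substT σ (s ⊕ t) = substT σ s ⊕ substT σ t
substT σ (s ⊗ t) = substT σ s ⊗ substT σ t

_[_] : {V W : Set} → Formula (Poly V) → (V → LTerm W) → Formula (LTerm W)
φ [ σ ] = mapF (substT σ) φ

prodT : {W : Set} (n : ℕ) → (Fin n → LTerm W) → LTerm W
prodT zero t = con (+ 1)
prodT (suc n) t = t fzero ⊗ prodT n (λ i → t (fsuc i))

sumℤ : (n : ℕ) → (Fin n → ℤ) → ℤ
sumℤ zero a = + 0
sumℤ (suc n) a = a fzero ℤ.+ sumℤ n (λ i → a (fsuc i))

-- Variables of φ(u, y⃗; w⃗): u, y₁..yₙ, and further free parameters w⃗.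
data LVar (n p : ℕ) : Set where
  u : LVar n p
  y : Fin n → LVar n p
  w : Fin p → LVar n p

data RVar (n p : ℕ) : Set where
  z : Fin n → RVar n p
  w : Fin p → RVar n p

-- Semantics in (ξ^ℤ; 0,1,ξ,+,·,<,=).  A variable's value ξ^a ∈ ξ^ℤ is
-- represented by its exponent a ∈ ℤ.

module Semantics (ℝ : RealField) (ξv : RealField.Carrier ℝ) where
  open RealField ℝ

  fromℕ : ℕ → Carrier
  fromℕ zero = 0#
  fromℕ (suc n) = 1# + fromℕ n

  fromℤ : ℤ → Carrier
  fromℤ (+ n) = fromℕ n
  fromℤ -[1+ n ] = - fromℕ (suc n)

  _^ℕ_ : Carrier → ℕ → Carrier
  x ^ℕ zero = 1#
  x ^ℕ suc n = x * (x ^ℕ n)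

  _^ℤ_ : Carrier → ℤ → Carrier
  x ^ℤ (+ n) = x ^ℕ n
  x ^ℤ -[1+ n ] = (x ⁻¹) ^ℕ suc n

  val : ℤ → Carrier
  val a = ξv ^ℤ a

  evalP : {V : Set} → (V → ℤ) → Poly V → Carrier
  evalP ρ (var v) = val (ρ v)
  evalP ρ ξ = ξv
  evalP ρ (con c) = fromℤ c
  evalP ρ (s ⊕ t) = evalP ρ s + evalP ρ t
  evalP ρ (s ⊗ t) = evalP ρ s * evalP ρ t

  evalL : {V : Set} → (V → ℤ) → LTerm V → Carrier
  evalL ρ (vpow v e) = val (ρ v) ^ℤ e
  evalL ρ (ξpow e) = ξv ^ℤ e
  evalL ρ (con c) = fromℤ c
  evalL ρ (s ⊕ t) = evalL ρ s + evalL ρ t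
  evalL ρ (s ⊗ t) = evalL ρ s * evalL ρ t

  Sat : {T : Set} → (T → Carrier) → Formula T → Set
  Sat ev tt = ⊤
  Sat ev ff = ⊥
  Sat ev (s ≐ t) = ev s ≡ ev t
  Sat ev (s ≺ t) = ev s < ev t
  Sat ev (a ∧ b) = Sat ev a × Sat ev b
  Sat ev (a ∨ b) = Sat ev a ⊎ Sat ev b
  Sat ev (¬' a) = ¬ Sat ev a

  module _ {n p : ℕ} (φ : Formula (Poly (LVar n p)))
           (j : ℕ) .{{_ : NonZero j}} (k : ℤ) (ℓ : Fin n → ℤ) where

    φL : Formula (LTerm (LVar n p))
    φL = φ [ (λ v → vpow v (+ 1)) ]

    LHSFormula : Formula (LTerm (LVar n p))
    LHSFormula = (vpow u (+ j) ≐ (ξpow k ⊗ prodT n (λ i → vpow (y i) (ℓ i)))) ∧ φL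

    envL : ℤ → (Fin n → ℤ) → (Fin p → ℤ) → LVar n p → ℤ
    envL a b ω u = a
    envL a b ω (y i) = b i
    envL a b ω (w m) = ω m

    LHS : (Fin p → ℤ) → Set
    LHS ω = Σ (Fin n → ℤ) λ b → Σ ℤ λ a →
              Sat (evalL (envL a b ω)) LHSFormula

    ℓ·r : (Fin n → Fin j) → ℤ
    ℓ·r r = sumℤ n (λ i → (+ toℕ (r i)) ℤ.* ℓ i)

    σ : (Fin n → Fin j) → LVar n p → LTerm (RVar n p)
    σ r u = ξpow ((k ℤ.+ ℓ·r r) /ℕ j) ⊗ prodT n (λ i → vpow (z i) (ℓ i))
    σ r (y i) = vpow (z i) (+ j) ⊗ ξpow (+ toℕ (r i))
    σ r (w m) = vpow (w m) (+ 1)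

    envR : (Fin n → ℤ) → (Fin p → ℤ) → RVar n p → ℤ
    envR c ω (z i) = c i
    envR c ω (w m) = ω m

    RHS : (Fin p → ℤ) → Set
    RHS ω = Σ (Fin n → Fin j) λ r →
              ((+ j) ℤD.∣ (k ℤ.+ ℓ·r r)) ×
              Σ (Fin n → ℤ) λ c → Sat (evalL (envR c ω)) (φ [ σ r ])

{-# OPTIONS --safe #-}
module Submission where

-- Represent every variable by its exponent: u = ξ^a, yᵢ = ξ^{bᵢ}. As ξ > 1, t ↦ ξ^t is injective
-- on ℤ, so the equation u^j = ξ^k·y⃗^ℓ⃗ says exactly a·j = k + Σ bᵢℓᵢ. Dividing bᵢ by j with
-- remainder, bᵢ = cᵢ·j + rᵢ with rᵢ ∈ [0..j-1], turns it into a·j = (k + ℓ⃗·r⃗) + j·Σ cᵢℓᵢ,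
-- which holds iff j ∣ k + ℓ⃗·r⃗ and a = (k + ℓ⃗·r⃗)/j + Σ cᵢℓᵢ. With zᵢ = ξ^{cᵢ}, the substitution
-- for r⃗ then gives every variable of φ its old value, so φ holds on one side iff on the other;
-- conversely every (r⃗, z⃗) on the right arises this way from bᵢ = cᵢ·j + rᵢ.

open import Defs
open import Data.Nat using (ℕ; NonZero)
open import Data.Integer using (ℤ)
open import Data.Fin using (Fin)
open import Function.Bundles using (_⇔_)

open import Level using (0ℓ)
import Data.Nat as ℕ
import Data.Nat.Properties as ℕ
import Data.Nat.Divisibility as ℕ
import Data.Integer as ℤ
open import Data.Integer using (+_; -[1+_]; _⊖_; ∣_∣)
import Data.Integer.Properties as ℤ
open import Data.Integer.Divisibility using (_∣_)
open import Data.Integer.DivMod using (_/ℕ_; _%ℕ_; n%ℕd<d; a≡a%ℕn+[a/ℕn]*n)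
open import Data.Integer.Tactic.RingSolver using (solve-∀)
open import Data.Fin using (toℕ; fromℕ<) renaming (zero to fzero; suc to fsuc)
open import Data.Fin.Properties using (toℕ-fromℕ<)
open import Data.Product using (_×_; _,_)
open import Data.Sum using (_⊎_)
open import Function.Base using (id)
open import Function.Bundles using (mk⇔; Equivalence)
open import Relation.Nullary using (¬_; contradiction)
open import Relation.Binary.PropositionalEquality hiding ([_])
open import Relation.Binary.Definitions using (tri<; tri≈; tri>)
open import Relation.Binary.Structures using (IsStrictTotalOrder)
open import Algebra.Bundles using (CommutativeRing)
import Algebra.Properties.Ring as RingProperties
import Algebra.Properties.CommutativeSemigroup as CommutativeSemigroupProperties

module _ where
  open import Data.Integer using (_+_; _*_; _-_)

  dot : ∀ {n} → (Fin n → ℤ) → (Fin n → ℤ) → ℤ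
  dot {n} b ℓ = sumℤ n (λ i → b i * ℓ i)

  dot-affine : ∀ {n} {b : Fin n → ℤ} m (c r ℓ : Fin n → ℤ) →
               (∀ i → b i ≡ c i * m + r i) → dot b ℓ ≡ m * dot c ℓ + dot r ℓ
  dot-affine {ℕ.zero} m c r ℓ _ = sym (trans (ℤ.+-identityʳ (m * + 0)) (ℤ.*-zeroʳ m))
  dot-affine {ℕ.suc n} {b} m c r ℓ b≡cm+r = begin
    b₀ * ℓ₀ + dot b′ ℓ′
      ≡⟨ cong₂ _+_ (cong (_* ℓ₀) (b≡cm+r fzero)) (dot-affine m c′ r′ ℓ′ (λ i → b≡cm+r (fsuc i))) ⟩
    (c₀ * m + r₀) * ℓ₀ + (m * dot c′ ℓ′ + dot r′ ℓ′)
      ≡⟨ rearrange c₀ m r₀ ℓ₀ (dot c′ ℓ′) (dot r′ ℓ′) ⟩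
    m * (c₀ * ℓ₀ + dot c′ ℓ′) + (r₀ * ℓ₀ + dot r′ ℓ′) ∎
    where
    open ≡-Reasoning
    b₀ c₀ r₀ ℓ₀ : ℤ
    b₀ = b fzero; c₀ = c fzero; r₀ = r fzero; ℓ₀ = ℓ fzero
    b′ c′ r′ ℓ′ : Fin n → ℤ
    b′ i = b (fsuc i); c′ i = c (fsuc i); r′ i = r (fsuc i); ℓ′ i = ℓ (fsuc i)
    rearrange : ∀ c m r l C R → (c * m + r) * l + (m * C + R) ≡ m * (c * l + C) + (r * l + R)
    rearrange = solve-∀

  module _ (j : ℕ) .{{_ : NonZero j}} where

    ∣⇒[x/ℕj]*j≡x : ∀ x → + j ∣ x → (x /ℕ j) * + j ≡ x
    ∣⇒[x/ℕj]*j≡x x j∣x = begin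
      (x /ℕ j) * + j                 ≡⟨ ℤ.+-identityˡ _ ⟨
      + 0 + (x /ℕ j) * + j           ≡⟨ cong (λ m → + m + (x /ℕ j) * + j) (x%j≡0 x j∣x) ⟨
      + (x %ℕ j) + (x /ℕ j) * + j    ≡⟨ a≡a%ℕn+[a/ℕn]*n x j ⟨
      x ∎
      where
      open ≡-Reasoning
      x%j≡0 : ∀ x → j ℕ.∣ ∣ x ∣ → x %ℕ j ≡ 0
      x%j≡0 (+ m) j∣m = ℕ.n∣m⇒m%n≡0 m j j∣m
      x%j≡0 -[1+ m ] j∣m with ℕ.suc m ℕ.% j in eq
      ... | ℕ.zero = refl
      ... | ℕ.suc _ = contradiction (trans (sym eq) (ℕ.n∣m⇒m%n≡0 (ℕ.suc m) j j∣m)) λ ()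

    remainder : ℤ → Fin j
    remainder x = fromℕ< (n%ℕd<d x j)

    x≡[x/ℕj]*j+remainder : ∀ x → x ≡ (x /ℕ j) * + j + + toℕ (remainder x)
    x≡[x/ℕj]*j+remainder x = begin
      x                                     ≡⟨ a≡a%ℕn+[a/ℕn]*n x j ⟩
      + (x %ℕ j) + (x /ℕ j) * + j           ≡⟨ ℤ.+-comm (+ (x %ℕ j)) ((x /ℕ j) * + j) ⟩
      (x /ℕ j) * + j + + (x %ℕ j)           ≡⟨ cong (λ m → (x /ℕ j) * + j + + m) (toℕ-fromℕ< (n%ℕd<d x j)) ⟨
      (x /ℕ j) * + j + + toℕ (remainder x)  ∎
      where open ≡-Reasoning

    a*j≡x+j*c⇔j∣x×a≡x/j+c : ∀ a x c → (a * + j ≡ x + + j * c) ⇔ (+ j ∣ x × a ≡ x /ℕ j + c)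
    a*j≡x+j*c⇔j∣x×a≡x/j+c a x c = mk⇔ to from
      where
      open ≡-Reasoning
      to : a * + j ≡ x + + j * c → + j ∣ x × a ≡ x /ℕ j + c
      to a*j≡x+j*c = j∣x , a≡x/j+c
        where
        a≡a+b-b : ∀ a b → a ≡ a + b - b
        a≡a+b-b = solve-∀
        a*j-j*c≡[a-c]*j : ∀ a c j → a * j - j * c ≡ (a - c) * j
        a*j-j*c≡[a-c]*j = solve-∀
        a≡a-c+c : ∀ a c → a ≡ a - c + c
        a≡a-c+c = solve-∀
        x≡[a-c]*j : x ≡ (a - c) * + j
        x≡[a-c]*j = begin
          x                        ≡⟨ a≡a+b-b x (+ j * c) ⟩
          (x + + j * c) - + j * c  ≡⟨ cong (_- + j * c) a*j≡x+j*c ⟨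
          a * + j - + j * c        ≡⟨ a*j-j*c≡[a-c]*j a c (+ j) ⟩
          (a - c) * + j            ∎
        j∣x : + j ∣ x
        j∣x = ℕ.divides ∣ a - c ∣ (trans (cong ∣_∣ x≡[a-c]*j) (ℤ.abs-* (a - c) (+ j)))
        x/j≡a-c : x /ℕ j ≡ a - c
        x/j≡a-c = ℤ.*-cancelʳ-≡ (x /ℕ j) (a - c) (+ j) (trans (∣⇒[x/ℕj]*j≡x x j∣x) x≡[a-c]*j)
        a≡x/j+c : a ≡ x /ℕ j + c
        a≡x/j+c = trans (a≡a-c+c a c) (cong (_+ c) (sym x/j≡a-c))
      from : + j ∣ x × a ≡ x /ℕ j + c → a * + j ≡ x + + j * c
      from (j∣x , refl) = begin
        (x /ℕ j + c) * + j       ≡⟨ ℤ.*-distribʳ-+ (+ j) (x /ℕ j) c ⟩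
        x /ℕ j * + j + c * + j   ≡⟨ cong₂ _+_ (∣⇒[x/ℕj]*j≡x x j∣x) (ℤ.*-comm c (+ j)) ⟩
        x + + j * c ∎

module _ (ℝ : RealField) where
  open RealField ℝ
  private
    ℝ-ring : CommutativeRing 0ℓ 0ℓ
    ℝ-ring = record { isCommutativeRing = isCommutativeRing }
  open CommutativeRing ℝ-ring using
    ( +-assoc; +-identityˡ; +-identityʳ; -‿inverseˡ; -‿inverseʳ
    ; *-assoc; *-comm; *-identityˡ; *-identityʳ; zeroˡ
    ; ring; *-commutativeSemigroup )
  open RingProperties ring using (-1*x≈-x; -‿involutive; [y-z]x≈yx-zx)
  open CommutativeSemigroupProperties *-commutativeSemigroup using (interchange)
  open IsStrictTotalOrder isStrictTotalOrder using (compare; irrefl) renaming (trans to <-trans)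

  ⁻¹-unique : ∀ {a b} → a * b ≡ 1# → a ⁻¹ ≡ b
  ⁻¹-unique {a} {b} ab≡1 = begin
    a ⁻¹              ≡⟨ *-identityʳ (a ⁻¹) ⟨
    a ⁻¹ * 1#         ≡⟨ cong (a ⁻¹ *_) ab≡1 ⟨
    a ⁻¹ * (a * b)    ≡⟨ *-assoc (a ⁻¹) a b ⟨
    (a ⁻¹ * a) * b    ≡⟨ cong (_* b) (trans (*-comm (a ⁻¹) a) (⁻¹-inverse a a≢0)) ⟩
    1# * b            ≡⟨ *-identityˡ b ⟩
    b                 ∎
    where
    open ≡-Reasoning
    a≢0 : a ≢ 0#
    a≢0 a≡0 = 0≢1 (trans (sym (zeroˡ b)) (trans (cong (_* b) (sym a≡0)) ab≡1))

  a<b⇒0<b-a : ∀ {a b} → a < b → 0# < b + - a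
  a<b⇒0<b-a {a} {b} a<b = subst (_< b + - a) (-‿inverseʳ a) (+-mono-< a b (- a) a<b)

  0<b-a⇒a<b : ∀ {a b} → 0# < b + - a → a < b
  0<b-a⇒a<b {a} {b} 0<b-a = subst₂ _<_ (+-identityˡ a) b-a+a≡b (+-mono-< 0# (b + - a) a 0<b-a)
    where
    b-a+a≡b : b + - a + a ≡ b
    b-a+a≡b = trans (+-assoc b (- a) a) (trans (cong (λ t → b + t) (-‿inverseˡ a)) (+-identityʳ b))

  0<1 : 0# < 1#
  0<1 with compare 0# 1#
  ... | tri< 0<1 _ _ = 0<1
  ... | tri≈ _ 0≡1 _ = contradiction 0≡1 0≢1
  ... | tri> _ _ 1<0 = contradiction (<-trans 1<0 0<[-1]*[-1]) (irrefl refl)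
    where
    0<-1 : 0# < - 1#
    0<-1 = subst (0# <_) (+-identityˡ (- 1#)) (a<b⇒0<b-a 1<0)
    0<[-1]*[-1] : 0# < 1#
    0<[-1]*[-1] = subst (0# <_) (trans (-1*x≈-x (- 1#)) (-‿involutive 1#)) (*-pos _ _ 0<-1 0<-1)

  *-monoʳ-<-pos : ∀ {a b c} → 0# < c → a < b → a * c < b * c
  *-monoʳ-<-pos {a} {b} {c} 0<c a<b =
    0<b-a⇒a<b (subst (0# <_) ([y-z]x≈yx-zx c b a) (*-pos _ _ (a<b⇒0<b-a a<b) 0<c))

  -- The name ξ is taken by the constructor of Poly.
  module _ (ξ′ : Carrier) where
    open Semantics ℝ ξ′

    ^ℕ-+ : ∀ x m n → x ^ℕ (m ℕ.+ n) ≡ x ^ℕ m * x ^ℕ n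
    ^ℕ-+ x ℕ.zero n = sym (*-identityˡ (x ^ℕ n))
    ^ℕ-+ x (ℕ.suc m) n = trans (cong (x *_) (^ℕ-+ x m n)) (sym (*-assoc x (x ^ℕ m) (x ^ℕ n)))

    module _ {x : Carrier} (x≢0 : x ≢ 0#) where

      ^ℤ-⊖ : ∀ m n → x ^ℤ (m ⊖ n) ≡ x ^ℕ m * (x ⁻¹) ^ℕ n
      ^ℤ-⊖ m ℕ.zero = sym (*-identityʳ (x ^ℕ m))
      ^ℤ-⊖ ℕ.zero (ℕ.suc n) = sym (*-identityˡ ((x ⁻¹) ^ℕ ℕ.suc n))
      ^ℤ-⊖ (ℕ.suc m) (ℕ.suc n) = begin
        x ^ℤ (ℕ.suc m ⊖ ℕ.suc n)                  ≡⟨ cong (x ^ℤ_) (ℤ.[1+m]⊖[1+n]≡m⊖n m n) ⟩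
        x ^ℤ (m ⊖ n)                              ≡⟨ ^ℤ-⊖ m n ⟩
        x ^ℕ m * (x ⁻¹) ^ℕ n                      ≡⟨ *-identityˡ _ ⟨
        1# * (x ^ℕ m * (x ⁻¹) ^ℕ n)               ≡⟨ cong (_* (x ^ℕ m * (x ⁻¹) ^ℕ n)) (⁻¹-inverse x x≢0) ⟨
        (x * x ⁻¹) * (x ^ℕ m * (x ⁻¹) ^ℕ n)       ≡⟨ interchange x (x ⁻¹) (x ^ℕ m) ((x ⁻¹) ^ℕ n) ⟩
        (x * x ^ℕ m) * (x ⁻¹ * (x ⁻¹) ^ℕ n)       ∎
        where open ≡-Reasoning

      -- In the mixed-sign cases m ℤ.+ n computes to a ⊖-expression.
      ^ℤ-+ : ∀ m n → x ^ℤ (m ℤ.+ n) ≡ x ^ℤ m * x ^ℤ n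
      ^ℤ-+ (+ m) (+ n) = ^ℕ-+ x m n
      ^ℤ-+ (+ m) -[1+ n ] = ^ℤ-⊖ m (ℕ.suc n)
      ^ℤ-+ -[1+ m ] (+ n) = trans (^ℤ-⊖ n (ℕ.suc m)) (*-comm (x ^ℕ n) _)
      ^ℤ-+ -[1+ m ] -[1+ n ] =
        trans (cong (λ e → (x ⁻¹) ^ℕ ℕ.suc e) (sym (ℕ.+-suc m n))) (^ℕ-+ (x ⁻¹) (ℕ.suc m) (ℕ.suc n))

      ^ℤ-inverseʳ : ∀ m → x ^ℤ m * x ^ℤ (ℤ.- m) ≡ 1#
      ^ℤ-inverseʳ m = trans (sym (^ℤ-+ m (ℤ.- m))) (cong (x ^ℤ_) (ℤ.+-inverseʳ m))

      ^ℤ-*ℕ : ∀ m n → (x ^ℤ m) ^ℕ n ≡ x ^ℤ (m ℤ.* + n)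
      ^ℤ-*ℕ m ℕ.zero = cong (x ^ℤ_) (sym (ℤ.*-zeroʳ m))
      ^ℤ-*ℕ m (ℕ.suc n) = begin
        x ^ℤ m * (x ^ℤ m) ^ℕ n        ≡⟨ cong (x ^ℤ m *_) (^ℤ-*ℕ m n) ⟩
        x ^ℤ m * x ^ℤ (m ℤ.* + n)     ≡⟨ ^ℤ-+ m (m ℤ.* + n) ⟨
        x ^ℤ (m ℤ.+ m ℤ.* + n)        ≡⟨ cong (x ^ℤ_) (ℤ.*-suc m (+ n)) ⟨
        x ^ℤ (m ℤ.* + ℕ.suc n)        ∎
        where open ≡-Reasoning

      ^ℤ-* : ∀ m e → (x ^ℤ m) ^ℤ e ≡ x ^ℤ (m ℤ.* e)
      ^ℤ-* m (+ n) = ^ℤ-*ℕ m n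
      ^ℤ-* m -[1+ n ] = begin
        ((x ^ℤ m) ⁻¹) ^ℕ ℕ.suc n           ≡⟨ cong (_^ℕ ℕ.suc n) (⁻¹-unique (^ℤ-inverseʳ m)) ⟩
        (x ^ℤ (ℤ.- m)) ^ℕ ℕ.suc n          ≡⟨ ^ℤ-*ℕ (ℤ.- m) (ℕ.suc n) ⟩
        x ^ℤ (ℤ.- m ℤ.* + ℕ.suc n)         ≡⟨ cong (x ^ℤ_) -m*n≡m*-n ⟩
        x ^ℤ (m ℤ.* -[1+ n ])              ∎
        where
        open ≡-Reasoning
        -m*n≡m*-n : ℤ.- m ℤ.* + ℕ.suc n ≡ m ℤ.* -[1+ n ]
        -m*n≡m*-n = trans (sym (ℤ.neg-distribˡ-* m (+ ℕ.suc n))) (ℤ.neg-distribʳ-* m (+ ℕ.suc n))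

    1<x⇒1<x^[1+n] : ∀ {x} → 1# < x → ∀ n → 1# < x ^ℕ ℕ.suc n
    1<x⇒1<x^[1+n] {x} 1<x ℕ.zero = subst (1# <_) (sym (*-identityʳ x)) 1<x
    1<x⇒1<x^[1+n] {x} 1<x (ℕ.suc n) = <-trans 1<xⁿ⁺¹ xⁿ⁺¹<x*xⁿ⁺¹
      where
      1<xⁿ⁺¹ : 1# < x ^ℕ ℕ.suc n
      1<xⁿ⁺¹ = 1<x⇒1<x^[1+n] 1<x n
      xⁿ⁺¹<x*xⁿ⁺¹ : x ^ℕ ℕ.suc n < x * x ^ℕ ℕ.suc n
      xⁿ⁺¹<x*xⁿ⁺¹ = subst (_< x * x ^ℕ ℕ.suc n) (*-identityˡ _) (*-monoʳ-<-pos (<-trans 0<1 1<xⁿ⁺¹) 1<x)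

    Sat-mapF : ∀ {T S : Set} {ev : S → Carrier} {ev′ : T → Carrier} (f : T → S) →
               (∀ t → ev (f t) ≡ ev′ t) → ∀ ψ → Sat ev (mapF f ψ) ≡ Sat ev′ ψ
    Sat-mapF f eq tt = refl
    Sat-mapF f eq ff = refl
    Sat-mapF f eq (s ≐ t) = cong₂ _≡_ (eq s) (eq t)
    Sat-mapF f eq (s ≺ t) = cong₂ _<_ (eq s) (eq t)
    Sat-mapF f eq (ψ ∧ χ) = cong₂ _×_ (Sat-mapF f eq ψ) (Sat-mapF f eq χ)
    Sat-mapF f eq (ψ ∨ χ) = cong₂ _⊎_ (Sat-mapF f eq ψ) (Sat-mapF f eq χ)
    Sat-mapF f eq (¬' ψ) = cong ¬_ (Sat-mapF f eq ψ)

    evalL-vpow¹ : ∀ {V : Set} (ρ : V → ℤ) v → evalL ρ (vpow v (+ 1)) ≡ val (ρ v)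
    evalL-vpow¹ ρ v = *-identityʳ (val (ρ v))

    module _ {V W : Set} (ρ′ : W → ℤ) (ρ : V → ℤ) (τ : V → LTerm W)
             (τ-sound : ∀ v → evalL ρ′ (τ v) ≡ val (ρ v)) where

      evalL-substT : ∀ t → evalL ρ′ (substT τ t) ≡ evalP ρ t
      evalL-substT (var v) = τ-sound v
      evalL-substT ξ = *-identityʳ ξ′
      evalL-substT (con c) = refl
      evalL-substT (s ⊕ t) = cong₂ _+_ (evalL-substT s) (evalL-substT t)
      evalL-substT (s ⊗ t) = cong₂ _*_ (evalL-substT s) (evalL-substT t)

      Sat-[] : ∀ ψ → Sat (evalL ρ′) (ψ [ τ ]) ≡ Sat (evalP ρ) ψ
      Sat-[] = Sat-mapF (substT τ) evalL-substT

    module _ (1<ξ : 1# < ξ′) where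

      ξ≢0 : ξ′ ≢ 0#
      ξ≢0 ξ≡0 = irrefl refl (subst (0# <_) ξ≡0 (<-trans 0<1 1<ξ))

      val≡1⇒≡0 : ∀ m → val m ≡ 1# → m ≡ + 0
      val≡1⇒≡0 (+ ℕ.zero) _ = refl
      val≡1⇒≡0 (+ ℕ.suc n) ξⁿ⁺¹≡1 =
        contradiction (subst (1# <_) ξⁿ⁺¹≡1 (1<x⇒1<x^[1+n] 1<ξ n)) (irrefl refl)
      val≡1⇒≡0 -[1+ n ] ξ⁻ⁿ⁻¹≡1 = contradiction (val≡1⇒≡0 (+ ℕ.suc n) ξⁿ⁺¹≡1) λ ()
        where
        ξⁿ⁺¹≡1 : val (+ ℕ.suc n) ≡ 1#
        ξⁿ⁺¹≡1 = begin
          val (+ ℕ.suc n)                     ≡⟨ *-identityʳ _ ⟨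
          val (+ ℕ.suc n) * 1#                ≡⟨ cong (val (+ ℕ.suc n) *_) ξ⁻ⁿ⁻¹≡1 ⟨
          val (+ ℕ.suc n) * val -[1+ n ]      ≡⟨ ^ℤ-inverseʳ ξ≢0 (+ ℕ.suc n) ⟩
          1#                                  ∎
          where open ≡-Reasoning

      val-injective : ∀ {m n} → val m ≡ val n → m ≡ n
      val-injective {m} {n} ξᵐ≡ξⁿ = ℤ.i-j≡0⇒i≡j m n (val≡1⇒≡0 (m ℤ.- n) ξᵐ⁻ⁿ≡1)
        where
        ξᵐ⁻ⁿ≡1 : val (m ℤ.- n) ≡ 1#
        ξᵐ⁻ⁿ≡1 = begin
          val (m ℤ.- n)              ≡⟨ ^ℤ-+ ξ≢0 m (ℤ.- n) ⟩
          val m * val (ℤ.- n)        ≡⟨ cong (_* val (ℤ.- n)) ξᵐ≡ξⁿ ⟩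
          val n * val (ℤ.- n)        ≡⟨ ^ℤ-inverseʳ ξ≢0 n ⟩
          1#                         ∎
          where open ≡-Reasoning

      evalL-prodT : ∀ {W : Set} (ρ : W → ℤ) {n} (v : Fin n → W) (e : Fin n → ℤ) →
                    evalL ρ (prodT n (λ i → vpow (v i) (e i))) ≡ val (dot (λ i → ρ (v i)) e)
      evalL-prodT ρ {ℕ.zero} v e = +-identityʳ 1#
      evalL-prodT ρ {ℕ.suc n} v e = trans
        (cong₂ _*_ (^ℤ-* ξ≢0 (ρ (v fzero)) (e fzero))
                   (evalL-prodT ρ (λ i → v (fsuc i)) (λ i → e (fsuc i))))
        (sym (^ℤ-+ ξ≢0 (ρ (v fzero) ℤ.* e fzero) _))

      module _ {n p : ℕ} (φ : Formula (Poly (LVar n p))) (j : ℕ) .{{_ : NonZero j}} (k : ℤ)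
               (ℓ : Fin n → ℤ) (ω : Fin p → ℤ) where

        Sat-equation⇔ : ∀ {a b} (r : Fin n → Fin j) (c : Fin n → ℤ) →
          (∀ i → b i ≡ c i ℤ.* + j ℤ.+ + toℕ (r i)) →
          Sat (evalL (envL φ j k ℓ a b ω)) (vpow u (+ j) ≐ (ξpow k ⊗ prodT n (λ i → vpow (y i) (ℓ i))))
          ⇔ (+ j ∣ k ℤ.+ ℓ·r φ j k ℓ r × a ≡ (k ℤ.+ ℓ·r φ j k ℓ r) /ℕ j ℤ.+ dot c ℓ)
        Sat-equation⇔ {a} {b} r c b≡cj+r = mk⇔
          (λ eq → Equivalence.to exponents⇔ (val-injective (trans (sym ξᵃ^j≡ξᵃʲ) (trans eq rhs≡))))
          (λ h → trans ξᵃ^j≡ξᵃʲ (trans (cong val (Equivalence.from exponents⇔ h)) (sym rhs≡)))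
          where
          open ≡-Reasoning
          R C : ℤ
          R = ℓ·r φ j k ℓ r
          C = dot c ℓ
          exponents⇔ : (a ℤ.* + j ≡ (k ℤ.+ R) ℤ.+ + j ℤ.* C)
                       ⇔ (+ j ∣ k ℤ.+ R × a ≡ (k ℤ.+ R) /ℕ j ℤ.+ C)
          exponents⇔ = a*j≡x+j*c⇔j∣x×a≡x/j+c j a (k ℤ.+ R) C
          ξᵃ^j≡ξᵃʲ : val a ^ℤ (+ j) ≡ val (a ℤ.* + j)
          ξᵃ^j≡ξᵃʲ = ^ℤ-* ξ≢0 a (+ j)
          k+[C*j+R]≡[k+R]+j*C : ∀ k C R j → k ℤ.+ (j ℤ.* C ℤ.+ R) ≡ (k ℤ.+ R) ℤ.+ j ℤ.* C
          k+[C*j+R]≡[k+R]+j*C = solve-∀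
          rhs≡ : val k * evalL (envL φ j k ℓ a b ω) (prodT n (λ i → vpow (y i) (ℓ i)))
                 ≡ val ((k ℤ.+ R) ℤ.+ + j ℤ.* C)
          rhs≡ = begin
            val k * evalL (envL φ j k ℓ a b ω) (prodT n (λ i → vpow (y i) (ℓ i)))
              ≡⟨ cong (val k *_) (evalL-prodT (envL φ j k ℓ a b ω) y ℓ) ⟩
            val k * val (dot b ℓ)
              ≡⟨ ^ℤ-+ ξ≢0 k (dot b ℓ) ⟨
            val (k ℤ.+ dot b ℓ)
              ≡⟨ cong (λ e → val (k ℤ.+ e)) (dot-affine (+ j) c (λ i → + toℕ (r i)) ℓ b≡cj+r) ⟩
            val (k ℤ.+ (+ j ℤ.* C ℤ.+ R))
              ≡⟨ cong val (k+[C*j+R]≡[k+R]+j*C k C R (+ j)) ⟩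
            val ((k ℤ.+ R) ℤ.+ + j ℤ.* C) ∎

        Sat-φ[σ]≡Sat-φL : ∀ {a b} (r : Fin n → Fin j) (c : Fin n → ℤ) →
          (∀ i → b i ≡ c i ℤ.* + j ℤ.+ + toℕ (r i)) →
          a ≡ (k ℤ.+ ℓ·r φ j k ℓ r) /ℕ j ℤ.+ dot c ℓ →
          Sat (evalL (envR φ j k ℓ c ω)) (φ [ σ φ j k ℓ r ])
            ≡ Sat (evalL (envL φ j k ℓ a b ω)) (φL φ j k ℓ)
        Sat-φ[σ]≡Sat-φL {a} {b} r c b≡cj+r a≡q+C =
          trans (Sat-[] (envR φ j k ℓ c ω) ρ (σ φ j k ℓ r) σ-sound φ)
                (sym (Sat-[] ρ ρ (λ v → vpow v (+ 1)) (evalL-vpow¹ ρ) φ))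
          where
          ρ : LVar n p → ℤ
          ρ = envL φ j k ℓ a b ω
          q : ℤ
          q = (k ℤ.+ ℓ·r φ j k ℓ r) /ℕ j
          σ-sound : ∀ v → evalL (envR φ j k ℓ c ω) (σ φ j k ℓ r v) ≡ val (ρ v)
          σ-sound u = trans (cong (val q *_) (evalL-prodT (envR φ j k ℓ c ω) z ℓ))
                        (trans (sym (^ℤ-+ ξ≢0 q (dot c ℓ))) (cong val (sym a≡q+C)))
          σ-sound (y i) = trans (cong (_* val (+ toℕ (r i))) (^ℤ-* ξ≢0 (c i) (+ j)))
                            (trans (sym (^ℤ-+ ξ≢0 (c i ℤ.* + j) _)) (cong val (sym (b≡cj+r i))))
          σ-sound (w m) = evalL-vpow¹ ω m

        LHS⇔RHS : LHS φ j k ℓ ω ⇔ RHS φ j k ℓ ω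
        LHS⇔RHS = mk⇔ to from
          where
          to : LHS φ j k ℓ ω → RHS φ j k ℓ ω
          to (b , a , ξᵃʲ≡ξᵏ·ξᵇˡ , sat) =
            let (j∣k+R , a≡q+C) = Equivalence.to (Sat-equation⇔ r c b≡cj+r) ξᵃʲ≡ξᵏ·ξᵇˡ
            in r , j∣k+R , c , subst id (sym (Sat-φ[σ]≡Sat-φL r c b≡cj+r a≡q+C)) sat
            where
            r : Fin n → Fin j
            r i = remainder j (b i)
            c : Fin n → ℤ
            c i = b i /ℕ j
            b≡cj+r : ∀ i → b i ≡ c i ℤ.* + j ℤ.+ + toℕ (r i)
            b≡cj+r i = x≡[x/ℕj]*j+remainder j (b i)

          from : RHS φ j k ℓ ω → LHS φ j k ℓ ω
          from (r , j∣k+R , c , sat) = b , a ,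
            Equivalence.from (Sat-equation⇔ r c b≡cj+r) (j∣k+R , refl) ,
            subst id (Sat-φ[σ]≡Sat-φL r c b≡cj+r refl) sat
            where
            b : Fin n → ℤ
            b i = c i ℤ.* + j ℤ.+ + toℕ (r i)
            b≡cj+r : ∀ i → b i ≡ c i ℤ.* + j ℤ.+ + toℕ (r i)
            b≡cj+r i = refl
            a : ℤ
            a = (k ℤ.+ ℓ·r φ j k ℓ r) /ℕ j ℤ.+ dot c ℓ

lemma5p5 : (ℝ : RealField) (ξ : RealField.Carrier ℝ) → RealField._<_ ℝ (RealField.1# ℝ) ξ →
    (n p : ℕ) (φ : Formula (Poly (LVar n p))) (j : ℕ) .{{_ : NonZero j}} (k : ℤ) (ℓ : Fin n → ℤ) →
    (ω : Fin p → ℤ) → Semantics.LHS ℝ ξ φ j k ℓ ω ⇔ Semantics.RHS ℝ ξ φ j k ℓ ω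
lemma5p5 ℝ ξ′ 1<ξ n p φ j k ℓ ω = LHS⇔RHS ℝ ξ′ 1<ξ φ j k ℓ ω
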